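{- Let $Z$ be a $\mathbb Z$-group, $N=\{a\in Z:a\ge0\}$, $N_\infty=N\cup\{\infty\}$. Let $a_1,\dots,a_n,b_1,\dots,b_n\in N_\infty$ be such that for each $i\le n$ there exists $k\in\mathbb N$ with $k a_i\ge b_i$, and suppose $a_1=\infty$. Then, in $\mathrm{Sym}\,N_\infty$, $a:=a_1\cdots a_n$ eats $b:=b_1\cdots b_n$, i.e., $a+b=a$.
   Context: A $\mathbb Z$-group is an elementary extension of $(\mathbb Z,0,+,-,<)$ in the language of ordered abelian groups. $N_\infty$ is a commutative monoid with $x+\infty=\infty$ and ordered with $x<\infty$ for $x\in N$. $\mathrm{Sym}\,N_\infty$ is the commutative semiring freely generated by symbols $[g]$, $g\in N_\infty$, modulo $[g]+[g']=[g+g']$, $[0]=0$, $[1]=1$; elements of $N_\infty$ are identified with their (injective) images $[g]$. -}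

module Defs where

open import Data.Nat using (ℕ; zero; suc)
open import Data.Fin using (Fin; toℕ)
import Data.Fin as F
open import Data.Product using (Σ; _×_; _,_)
open import Data.Sum using (_⊎_; inj₁; inj₂)
open import Data.Empty using (⊥)
open import Relation.Nullary using (¬_)
open import Relation.Binary.PropositionalEquality using (_≡_; refl; sym; subst)

-- Z-groups: models of the complete theory of (ℤ,0,+,-,<) (Presburger
-- arithmetic), i.e. discretely ordered abelian groups with least positive
-- element 1 satisfying division with remainder by every n ≥ 1.
-- The constant 1 is definable (least positive element) and is included
-- for convenience; the axioms determine it uniquely.

nfold : {A : Set} → A → (A → A → A) → ℕ → A → A
nfold z _+_ zero    x = z
nfold z _+_ (suc n) x = x + nfold z _+_ n x

record ZGroup : Set₁ where
  infixl 6 _+_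
  infix 4 _<_
  field
    Carrier : Set
    0# 1#   : Carrier
    _+_     : Carrier → Carrier → Carrier
    -_      : Carrier → Carrier
    _<_     : Carrier → Carrier → Set
    +-assoc     : ∀ x y z → (x + y) + z ≡ x + (y + z)
    +-comm      : ∀ x y → x + y ≡ y + x
    +-identityˡ : ∀ x → 0# + x ≡ x
    -‿inverseˡ  : ∀ x → (- x) + x ≡ 0#
    <-irrefl : ∀ x → ¬ (x < x)
    <-trans  : ∀ {x y z} → x < y → y < z → x < z
    <-tri    : ∀ x y → x < y ⊎ (x ≡ y ⊎ y < x)
    +-mono-< : ∀ {x y} z → x < y → x + z < y + z
    0<1      : 0# < 1#
    discrete : ∀ x → ¬ (0# < x × x < 1#)

    -- division with remainder by every n ≥ 1 (here n = suc m)
    divmod : ∀ (m : ℕ) x → Σ Carrier λ y → Σ (Fin (suc m)) λ r →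
               x ≡ nfold 0# _+_ (suc m) y + nfold 0# _+_ (toℕ r) 1#

  infix 4 _≤_
  _≤_ : Carrier → Carrier → Set
  x ≤ y = x < y ⊎ x ≡ y

  0≤+ : ∀ {a b} → 0# ≤ a → 0# ≤ b → 0# ≤ a + b
  0≤+ {a} {b} (inj₂ refl) q = subst (0# ≤_) (sym (+-identityˡ b)) q
  0≤+ {a} {b} (inj₁ p) q with +-mono-< b p
  ... | r with subst (_< a + b) (+-identityˡ b) r
  ... | s with q
  ... | inj₁ t = inj₁ (<-trans t s)
  ... | inj₂ refl = inj₁ s

-- N∞ = {a ∈ Z : a ≥ 0} ∪ {∞}, as a commutative monoid with x + ∞ = ∞,
-- ordered with x < ∞.  (Non-negativity proof is irrelevant, so
-- elements are determined by their value.)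

module _ (Z : ZGroup) where
  open ZGroup Z

  data N∞ : Set where
    fin : (a : Carrier) → .(0# ≤ a) → N∞
    ∞   : N∞

  infixl 6 _⊹_
  _⊹_ : N∞ → N∞ → N∞
  fin a p ⊹ fin b q = fin (a + b) (0≤+ p q)
  fin a p ⊹ ∞       = ∞
  ∞       ⊹ y       = ∞

  zero∞ : N∞
  zero∞ = fin 0# (inj₂ refl)

  one∞ : N∞
  one∞ = fin 1# (inj₁ 0<1)

  _·∞_ : ℕ → N∞ → N∞
  zero  ·∞ x = zero∞
  suc k ·∞ x = x ⊹ (k ·∞ x)

  data _≤∞_ : N∞ → N∞ → Set where
    fin≤fin : ∀ {a b} .{p q} → a ≤ b → fin a p ≤∞ fin b q
    ≤∞∞     : ∀ {x} → x ≤∞ ∞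

  -- Sym N∞: the commutative semiring freely generated by symbols [g],
  -- g ∈ N∞, modulo [g]+[g'] = [g+g'], [0] = 0, [1] = 1.  Presented as
  -- terms modulo the least congruence containing the commutative
  -- semiring axioms and these relations.

  infixl 6 _⊕_
  infixl 7 _⊗_
  data Sym : Set where
    [_] : N∞ → Sym
    𝟘 𝟙 : Sym
    _⊕_ _⊗_ : Sym → Sym → Sym

  infix 4 _≈_
  data _≈_ : Sym → Sym → Set where
    ≈-refl  : ∀ {x} → x ≈ x
    ≈-sym   : ∀ {x y} → x ≈ y → y ≈ x
    ≈-trans : ∀ {x y z} → x ≈ y → y ≈ z → x ≈ z
    ⊕-cong  : ∀ {x x' y y'} → x ≈ x' → y ≈ y' → x ⊕ y ≈ x' ⊕ y'
    ⊗-cong  : ∀ {x x' y y'} → x ≈ x' → y ≈ y' → x ⊗ y ≈ x' ⊗ y'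
    ⊕-assoc : ∀ x y z → (x ⊕ y) ⊕ z ≈ x ⊕ (y ⊕ z)
    ⊕-comm  : ∀ x y → x ⊕ y ≈ y ⊕ x
    ⊕-identityˡ : ∀ x → 𝟘 ⊕ x ≈ x
    ⊗-assoc : ∀ x y z → (x ⊗ y) ⊗ z ≈ x ⊗ (y ⊗ z)
    ⊗-comm  : ∀ x y → x ⊗ y ≈ y ⊗ x
    ⊗-identityˡ : ∀ x → 𝟙 ⊗ x ≈ x
    distribˡ : ∀ x y z → x ⊗ (y ⊕ z) ≈ (x ⊗ y) ⊕ (x ⊗ z)
    zeroˡ   : ∀ x → 𝟘 ⊗ x ≈ 𝟘
    gen-+   : ∀ g g' → [ g ] ⊕ [ g' ] ≈ [ g ⊹ g' ]
    gen-0   : [ zero∞ ] ≈ 𝟘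
    gen-1   : [ one∞ ] ≈ 𝟙

  prod : ∀ n → (Fin n → N∞) → Sym
  prod zero    a = 𝟙
  prod (suc n) a = [ a F.zero ] ⊗ prod n (λ i → a (F.suc i))

  Eats : Sym → Sym → Set
  Eats x y = x ⊕ y ≈ x

module Submission where

-- Proof idea.  Write a = [∞] ⊗ A' and b = [b₁] ⊗ B', where A', B' are the
-- products of the remaining generators.  Two facts do all the work.
--
-- (1) [∞] eats every generator ([∞] ⊕ [g] ≈ [∞ ⊹ g] = [∞]), hence [∞] ⊗ B'
--     eats [b₁] ⊗ B' = b; and eating passes from y to any x ≽ y, where
--     y ≼ x ("x ≈ y ⊕ c for some c") is the natural preorder of Sym N∞.
--
-- (2) "Up to a factor [∞]" the b's are below the a's: write y ⊑∞ x for
--     [∞] ⊗ y ≼ [∞] ⊗ x.  If b ≤ k·a then [b] ≼ [(k+1)·a] = (k+1) ⊗ [a], and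
--     [∞] ⊗ (k+1) ≈ [(k+1)·∞] = [∞]; so [b] ⊑∞ [a].  The relation ⊑∞ is
--     closed under products, so B' ⊑∞ A', i.e. [∞] ⊗ B' ≼ [∞] ⊗ A' = a.

open import Defs
open import Data.Nat using (ℕ; suc)
open import Data.Fin using (Fin; zero)
open import Data.Product using (Σ)
open import Relation.Binary.PropositionalEquality using (_≡_)
import Data.Nat as ℕ
import Data.Fin as F
open import Data.Product using (_,_)
open import Data.Sum using (inj₁; inj₂)
open import Function using (_∘_)
open import Level using (0ℓ)
open import Relation.Binary.Bundles using (Preorder)
open import Relation.Binary.PropositionalEquality
  using (refl; sym; trans; cong; subst; module ≡-Reasoning)
import Relation.Binary.Reasoning.Preorder as PreorderReasoning

module SymTheory (Z : ZGroup) where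
  open ZGroup Z using (0#; _+_; -_; _<_; +-assoc; +-comm; +-identityˡ;
                       -‿inverseˡ; +-mono-<)
    renaming (_≤_ to _≤Z_)

  distribʳ : ∀ z x y → _≈_ Z ((x ⊕ y) ⊗ z) ((x ⊗ z) ⊕ (y ⊗ z))
  distribʳ z x y = ≈-trans (⊗-comm (x ⊕ y) z)
    (≈-trans (distribˡ z x y) (⊕-cong (⊗-comm z x) (⊗-comm z y)))

  ⊕-swapʳ : ∀ x y z → _≈_ Z ((x ⊕ y) ⊕ z) ((x ⊕ z) ⊕ y)
  ⊕-swapʳ x y z = ≈-trans (⊕-assoc x y z)
    (≈-trans (⊕-cong ≈-refl (⊕-comm y z)) (≈-sym (⊕-assoc x z y)))

  infix 4 _≼_
  _≼_ : Sym Z → Sym Z → Set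
  y ≼ x = Σ (Sym Z) λ c → _≈_ Z x (y ⊕ c)

  ≼-preorder : Preorder 0ℓ 0ℓ 0ℓ
  ≼-preorder = record
    { Carrier    = Sym Z
    ; _≈_        = _≈_ Z
    ; _≲_        = _≼_
    ; isPreorder = record
      { isEquivalence = record { refl = ≈-refl ; sym = ≈-sym ; trans = ≈-trans }
      ; reflexive     = λ {x} x≈y → 𝟘 , ≈-trans (≈-sym x≈y) (≈-sym (⊕-identityʳ x))
      ; trans         = λ { {x} {y} {z} (c , y≈x⊕c) (d , z≈y⊕d) →
                            c ⊕ d , ≈-trans z≈y⊕d (≈-trans (⊕-cong y≈x⊕c ≈-refl) (⊕-assoc x c d)) }
      }
    }
    where
      ⊕-identityʳ : ∀ x → _≈_ Z (x ⊕ 𝟘) x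
      ⊕-identityʳ x = ≈-trans (⊕-comm x 𝟘) (⊕-identityˡ x)

  module ≼-Reasoning = PreorderReasoning ≼-preorder

  ≼-mulʳ : ∀ z {x y} → y ≼ x → y ⊗ z ≼ x ⊗ z
  ≼-mulʳ z {x} {y} (c , x≈y⊕c) = c ⊗ z , ≈-trans (⊗-cong x≈y⊕c ≈-refl) (distribʳ z y c)

  eats-≼ : ∀ {x y w} → y ≼ x → Eats Z y w → Eats Z x w
  eats-≼ {x} {y} {w} (c , x≈y⊕c) y-eats-w = begin-equality
    x ⊕ w        ≈⟨ ⊕-cong x≈y⊕c ≈-refl ⟩
    (y ⊕ c) ⊕ w  ≈⟨ ⊕-swapʳ y c w ⟩
    (y ⊕ w) ⊕ c  ≈⟨ ⊕-cong y-eats-w ≈-refl ⟩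
    y ⊕ c        ≈⟨ x≈y⊕c ⟨
    x            ∎
    where open ≼-Reasoning

  eats-mulʳ : ∀ z {x y} → Eats Z x y → Eats Z (x ⊗ z) (y ⊗ z)
  eats-mulʳ z {x} {y} x-eats-y = ≈-trans (≈-sym (distribʳ z x y)) (⊗-cong x-eats-y ≈-refl)

  -- [∞] eats every generator, since ∞ ⊹ g = ∞.
  ∞-eats : ∀ g → Eats Z [ ∞ ] [ g ]
  ∞-eats g = gen-+ ∞ g

  infix 4 _⊑∞_
  _⊑∞_ : Sym Z → Sym Z → Set
  y ⊑∞ x = [ ∞ ] ⊗ y ≼ [ ∞ ] ⊗ x

  -- ⊑∞ is closed under products; only one factor [∞] is ever needed.
  ⊑∞-mul : ∀ {x x' y y'} → y ⊑∞ x → y' ⊑∞ x' → y ⊗ y' ⊑∞ x ⊗ x'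
  ⊑∞-mul {x} {x'} {y} {y'} y⊑x y'⊑x' = begin
    [ ∞ ] ⊗ (y ⊗ y')    ≈⟨ ⊗-assoc [ ∞ ] y y' ⟨
    ([ ∞ ] ⊗ y) ⊗ y'    ≲⟨ ≼-mulʳ y' y⊑x ⟩
    ([ ∞ ] ⊗ x) ⊗ y'    ≈⟨ ⊗-assoc [ ∞ ] x y' ⟩
    [ ∞ ] ⊗ (x ⊗ y')    ≈⟨ ⊗-cong ≈-refl (⊗-comm x y') ⟩
    [ ∞ ] ⊗ (y' ⊗ x)    ≈⟨ ⊗-assoc [ ∞ ] y' x ⟨
    ([ ∞ ] ⊗ y') ⊗ x    ≲⟨ ≼-mulʳ x y'⊑x' ⟩
    ([ ∞ ] ⊗ x') ⊗ x    ≈⟨ ⊗-assoc [ ∞ ] x' x ⟩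
    [ ∞ ] ⊗ (x' ⊗ x)    ≈⟨ ⊗-cong ≈-refl (⊗-comm x' x) ⟩
    [ ∞ ] ⊗ (x ⊗ x')    ∎
    where open ≼-Reasoning

  ≤∞-complement : ∀ {b y} → _≤∞_ Z b y → Σ (N∞ Z) λ c → _⊹_ Z b c ≡ y
  ≤∞-complement {fin _ _} ≤∞∞ = ∞ , refl
  ≤∞-complement {∞}       ≤∞∞ = ∞ , refl
  ≤∞-complement (fin≤fin {u} {v} u≤v) = fin (v + - u) (difference-nonneg u≤v) , fin-cong u+[v-u]≡v
    where
      fin-cong : ∀ {s t} .{p q} → s ≡ t → fin s p ≡ fin {Z} t q
      fin-cong refl = refl

      u-u≡0 : u + - u ≡ 0#
      u-u≡0 = trans (+-comm u (- u)) (-‿inverseˡ u)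

      difference-nonneg : u ≤Z v → 0# ≤Z v + - u
      difference-nonneg (inj₁ u<v)  = inj₁ (subst (_< v + - u) u-u≡0 (+-mono-< (- u) u<v))
      difference-nonneg (inj₂ refl) = inj₂ (sym u-u≡0)

      u+[v-u]≡v : u + (v + - u) ≡ v
      u+[v-u]≡v = begin
        u + (v + - u)  ≡⟨ cong (u +_) (+-comm v (- u)) ⟩
        u + (- u + v)  ≡⟨ +-assoc u (- u) v ⟨
        (u + - u) + v  ≡⟨ cong (_+ v) u-u≡0 ⟩
        0# + v         ≡⟨ +-identityˡ v ⟩
        v              ∎
        where open ≡-Reasoning

  ≤∞⇒≼ : ∀ {g h} → _≤∞_ Z g h → [ g ] ≼ [ h ]
  ≤∞⇒≼ {g} g≤h with ≤∞-complement g≤h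
  ... | c , refl = [ c ] , ≈-sym (gen-+ g c)

  numeral : ℕ → Sym Z
  numeral ℕ.zero    = 𝟘
  numeral (suc m)   = 𝟙 ⊕ numeral m

  numeral-· : ∀ m g → _≈_ Z (numeral m ⊗ [ g ]) [ _·∞_ Z m g ]
  numeral-· ℕ.zero  g = ≈-trans (zeroˡ [ g ]) (≈-sym gen-0)
  numeral-· (suc m) g = ≈-trans (distribʳ [ g ] 𝟙 (numeral m))
    (≈-trans (⊕-cong (⊗-identityˡ [ g ]) (numeral-· m g)) (gen-+ g (_·∞_ Z m g)))

  generator-⊑∞ : ∀ {a b} → Σ ℕ (λ k → _≤∞_ Z b (_·∞_ Z k a)) → [ b ] ⊑∞ [ a ]
  generator-⊑∞ {a} {b} (k , b≤ka) = begin
    [ ∞ ] ⊗ [ b ]                        ≈⟨ ⊗-comm [ ∞ ] [ b ] ⟩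
    [ b ] ⊗ [ ∞ ]                        ≲⟨ ≼-mulʳ [ ∞ ] b≼[suc-k·a] ⟩
    [ _·∞_ Z (suc k) a ] ⊗ [ ∞ ]         ≈⟨ ⊗-cong (numeral-· (suc k) a) ≈-refl ⟨
    (numeral (suc k) ⊗ [ a ]) ⊗ [ ∞ ]    ≈⟨ ⊗-assoc (numeral (suc k)) [ a ] [ ∞ ] ⟩
    numeral (suc k) ⊗ ([ a ] ⊗ [ ∞ ])    ≈⟨ ⊗-cong ≈-refl (⊗-comm [ a ] [ ∞ ]) ⟩
    numeral (suc k) ⊗ ([ ∞ ] ⊗ [ a ])    ≈⟨ ⊗-assoc (numeral (suc k)) [ ∞ ] [ a ] ⟨
    (numeral (suc k) ⊗ [ ∞ ]) ⊗ [ a ]    ≈⟨ ⊗-cong (numeral-· (suc k) ∞) ≈-refl ⟩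
    [ ∞ ] ⊗ [ a ]                        ∎
    where
      open ≼-Reasoning
      b≼[suc-k·a] : [ b ] ≼ [ _·∞_ Z (suc k) a ]
      b≼[suc-k·a] = begin
        [ b ]                      ≲⟨ ≤∞⇒≼ b≤ka ⟩
        [ _·∞_ Z k a ]             ≲⟨ [ a ] , ⊕-comm [ a ] [ _·∞_ Z k a ] ⟩
        [ a ] ⊕ [ _·∞_ Z k a ]     ≈⟨ gen-+ a (_·∞_ Z k a) ⟩
        [ _·∞_ Z (suc k) a ]       ∎

  prod-⊑∞ : ∀ n (a b : Fin n → N∞ Z) →
    (∀ i → Σ ℕ λ k → _≤∞_ Z (b i) (_·∞_ Z k (a i))) → prod Z n b ⊑∞ prod Z n a
  prod-⊑∞ ℕ.zero  _ _ _       = Preorder.refl ≼-preorder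
  prod-⊑∞ (suc n) a b bounded =
    ⊑∞-mul (generator-⊑∞ (bounded zero))
           (prod-⊑∞ n (a ∘ F.suc) (b ∘ F.suc) (bounded ∘ F.suc))

-- With a₁ = ∞: [∞] ⊗ B' eats [b₁] ⊗ B' = b, and [∞] ⊗ B' ≼ [∞] ⊗ A' = a.
lemma2p11 : (Z : ZGroup) (n : ℕ) (a b : Fin (suc n) → N∞ Z) →
    (∀ i → Σ ℕ λ k → _≤∞_ Z (b i) (_·∞_ Z k (a i))) →
    a zero ≡ ∞ →
    Eats Z (prod Z (suc n) a) (prod Z (suc n) b)
lemma2p11 Z n a b bounded a₁≡∞ =
  subst (λ g → Eats Z ([ g ] ⊗ A′) (prod Z (suc n) b)) (sym a₁≡∞)
    (eats-≼ (prod-⊑∞ n (a ∘ F.suc) (b ∘ F.suc) (bounded ∘ F.suc))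
            (eats-mulʳ B′ (∞-eats (b zero))))
  where
    open SymTheory Z
    A′ B′ : Sym Z
    A′ = prod Z n (a ∘ F.suc)
    B′ = prod Z n (b ∘ F.suc)
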